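{- Let $G$ be a finite simple graph, $A_1,A_2$ disjoint subsets of $V(G)$, and $G^*$ the graph obtained by toggling all pairs between $A_1$ and $A_2$, with closed neighborhood matrices $N$ and $N^*$. Suppose $A_1$ is an NO set and $A_2$ is an AO set in $G$, and $A_2$ is $\overline{\mathbf{x}_{A_1}}$-NO in $G$. Then for every pattern $\mathbf{p}$, $N^*\mathbf{p}=\mathbf{1}$ if and only if $N\mathbf{p}=\overline{\mathbf{x}_{A_2}}$ or $N\mathbf{p}=\overline{\mathbf{x}_{A_1\cup A_2}}$. Moreover, $A_1$ is AO and $A_2$ is HO in $G^*$, and $\nu(G^*)=\nu(G)+1$.
   Context: For a graph $H$ with vertex set $V=\{v_1,\dots,v_n\}$, $N(H)$ is the closed neighborhood matrix over $\mathbb{Z}_2$ (entry $(i,j)$ is $1$ iff $i=j$ or $v_iv_j$ is an edge), $\nu(H)=\dim\ker N(H)$. Given disjoint $A_1,A_2\subseteq V(G)$, $G^*$ is obtained from $G$ by, for every $u\in A_1$, $v\in A_2$, adding the edge $uv$ if $u,v$ are non-adjacent and removing it if they are adjacent; $N=N(G)$, $N^*=N(G^*)$. Subsets $A$ are identified with characteristic vectors $\mathbf{x}_A$; $\mathbf{x}\cdot\mathbf{y}=\mathbf{x}^t\mathbf{y}$ over $\mathbb{Z}_2$; $\mathbf{1}$ is the all-ones vector, $\overline{\mathbf{x}}:=\mathbf{x}+\mathbf{1}$. In a graph $H$ with matrix $M$: a pattern $\mathbf{p}$ solves configuration $\mathbf{c}$ if $M\mathbf{p}=\mathbf{c}$;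 $\mathbf{c}$ (or a set $A$ via $\mathbf{x}_A$) is solvable if some pattern solves it; $\mathbf{1}$ is always solvable. A set $A$ is HO if it is not solvable. For solvable $A$ and solvable $\mathbf{c}$, $A$ is $\mathbf{c}$-AO if $\mathbf{x}_A\cdot\mathbf{p}=1$ for all solving patterns $\mathbf{p}$ of $\mathbf{c}$, and $\mathbf{c}$-NO if $\mathbf{x}_A\cdot\mathbf{p}=0$ for all of them; AO and NO mean $\mathbf{1}$-AO and $\mathbf{1}$-NO. -}

module Defs where

open import Data.Nat using (ℕ; suc)
open import Data.Bool using (Bool; true; false; _∧_; _∨_; _xor_; not; if_then_else_)
open import Data.Bool.Properties using (∨-comm; ∧-comm)
open import Data.Fin using (Fin; _≟_)
open import Data.Fin.Properties using ()
open import Data.Product using (Σ; _×_; _,_; ∃)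
open import Data.Sum using (_⊎_)
open import Function.Bundles using (_⇔_)
open import Relation.Nullary using (¬_; does)
open import Relation.Binary.PropositionalEquality using (_≡_; refl; cong; cong₂; trans; _≗_)

-- Linear algebra over ℤ₂ = Bool (addition = xor, multiplication = ∧)

Vec₂ : ℕ → Set
Vec₂ n = Fin n → Bool

Mat₂ : ℕ → ℕ → Set
Mat₂ n m = Fin n → Fin m → Bool

Σ₂ : ∀ {n} → (Fin n → Bool) → Bool
Σ₂ {ℕ.zero} f = false
Σ₂ {suc n} f = f Fin.zero xor Σ₂ (λ i → f (Fin.suc i))

_·_ : ∀ {n} → Vec₂ n → Vec₂ n → Bool
x · y = Σ₂ (λ i → x i ∧ y i)

_⊛_ : ∀ {n m} → Mat₂ n m → Vec₂ m → Vec₂ n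
(M ⊛ x) i = Σ₂ (λ j → M i j ∧ x j)

𝟎 : ∀ {n} → Vec₂ n
𝟎 _ = false

𝟏 : ∀ {n} → Vec₂ n
𝟏 _ = true

‾ : ∀ {n} → Vec₂ n → Vec₂ n
‾ x i = x i xor true

-- union of subsets (as characteristic vectors)
_∪_ : ∀ {n} → Vec₂ n → Vec₂ n → Vec₂ n
(A ∪ B) i = A i ∨ B i

lincomb : ∀ {n k} → (Fin k → Vec₂ n) → Vec₂ k → Vec₂ n
lincomb v c j = Σ₂ (λ i → c i ∧ v i j)

InKer : ∀ {n m} → Mat₂ n m → Vec₂ m → Set
InKer M x = M ⊛ x ≗ 𝟎

IsKerBasis : ∀ {n m k} → Mat₂ n m → (Fin k → Vec₂ m) → Set
IsKerBasis {k = k} M v =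
  ((i : Fin k) → InKer M (v i)) ×
  ((c : Vec₂ k) → lincomb v c ≗ 𝟎 → c ≗ 𝟎) ×
  ((x : Vec₂ _) → InKer M x → Σ (Vec₂ k) λ c → lincomb v c ≗ x)

HasNullity : ∀ {n m} → Mat₂ n m → ℕ → Set
HasNullity M k = Σ (Fin k → Vec₂ _) λ v → IsKerBasis M v

record Graph (n : ℕ) : Set where
  field
    adj   : Fin n → Fin n → Bool
    adj-sym : ∀ u v → adj u v ≡ adj v u
    adj-irrefl : ∀ v → adj v v ≡ false
open Graph public

N : ∀ {n} → Graph n → Mat₂ n n
N H i j = does (i ≟ j) ∨ adj H i j

ν≡ : ∀ {n} → Graph n → ℕ → Set
ν≡ H k = HasNullity (N H) k

Disjoint : ∀ {n} → Vec₂ n → Vec₂ n → Set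
Disjoint A₁ A₂ = ∀ v → A₁ v ∧ A₂ v ≡ false

private
  cross : ∀ {n} → Vec₂ n → Vec₂ n → Fin n → Fin n → Bool
  cross A₁ A₂ u v = (A₁ u ∧ A₂ v) ∨ (A₂ u ∧ A₁ v)

  cross-sym : ∀ {n} (A₁ A₂ : Vec₂ n) u v → cross A₁ A₂ u v ≡ cross A₁ A₂ v u
  cross-sym A₁ A₂ u v =
    trans (cong₂ _∨_ (∧-comm (A₁ u) (A₂ v)) (∧-comm (A₂ u) (A₁ v)))
          (∨-comm (A₂ v ∧ A₁ u) (A₁ v ∧ A₂ u))

  cross-irr : ∀ {n} (A₁ A₂ : Vec₂ n) → Disjoint A₁ A₂ → ∀ v → cross A₁ A₂ v v ≡ false
  cross-irr A₁ A₂ d v rewrite d v | ∧-comm (A₂ v) (A₁ v) | d v = refl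

toggle : ∀ {n} (G : Graph n) (A₁ A₂ : Vec₂ n) → Disjoint A₁ A₂ → Graph n
toggle G A₁ A₂ d = record
  { adj = λ u v → adj G u v xor cross A₁ A₂ u v
  ; adj-sym = λ u v → cong₂ _xor_ (adj-sym G u v) (cross-sym A₁ A₂ u v)
  ; adj-irrefl = λ v → cong₂ _xor_ (adj-irrefl G v) (cross-irr A₁ A₂ d v)
  }

Solves : ∀ {n} → Graph n → Vec₂ n → Vec₂ n → Set
Solves H p c = N H ⊛ p ≗ c

Solvable : ∀ {n} → Graph n → Vec₂ n → Set
Solvable H c = ∃ λ p → Solves H p c

HO : ∀ {n} → Graph n → Vec₂ n → Set
HO H A = ¬ Solvable H A

_-AO : ∀ {n} → Vec₂ n → Graph n → Vec₂ n → Set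
(c -AO) H A = Solvable H A × Solvable H c × (∀ p → Solves H p c → A · p ≡ true)

_-NO : ∀ {n} → Vec₂ n → Graph n → Vec₂ n → Set
(c -NO) H A = Solvable H A × Solvable H c × (∀ p → Solves H p c → A · p ≡ false)

AO NO : ∀ {n} → Graph n → Vec₂ n → Set
AO = 𝟏 -AO
NO = 𝟏 -NO

{-# OPTIONS --safe #-}
-- Over ℤ₂ toggling is the rank-two update N* = N + x₁x₂ᵗ + x₂x₁ᵗ (xᵢ the vector of Aᵢ), so
-- N* p = N p + (A₂·p) A₁ + (A₁·p) A₂. As N is symmetric with unit diagonal, N q = a and N p = c
-- give a·p = q·c, and q·Nq = q·𝟏. Fix qᵢ with N qᵢ = Aᵢ: the hypotheses amount to q₁·𝟏 = 0,
-- q₂·𝟏 = 1 and q₂·A₁ = 1, which fixes every product qᵢ·Aⱼ. Hence N* q₂ = A₁, so A₁·p = q₂·𝟏 = 1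
-- for every solution of N* p = 𝟏, and these are the solutions of N p = 𝟏 + (A₂·p) A₁ + A₂.
-- Also N* q₁ = 0 while A₂·q₁ = 1, so A₂ is HO; and ker N is the hyperplane A₂·x = 0 of
-- ker N*, which q₁ avoids, so the nullity grows by exactly one.
module Submission where

open import Defs
open import Data.Nat using (ℕ; zero; suc)
open import Data.Bool using (Bool; true; false; _∧_; _∨_; _xor_)
open import Data.Bool.Properties
  using (xor-∧-commutativeRing; xor-identityʳ; xor-same; ∧-idem; xor-comm; xor-assoc;
         ∧-comm; ∧-assoc; ∧-zeroʳ; ∧-identityʳ; ∧-distribˡ-xor)
open import Algebra.Bundles using (CommutativeRing)
open import Algebra.Properties.CommutativeSemigroup
  (CommutativeRing.+-commutativeSemigroup xor-∧-commutativeRing) using (interchange; x∙yz≈y∙xz)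
open import Data.Fin using (Fin; _≟_) renaming (zero to fzero; suc to fsuc)
open import Data.Vec.Functional using (_∷_; tail; insertAt; removeAt)
open import Data.Vec.Functional.Properties using (insertAt-lookup; removeAt-insertAt)
open import Data.Product using (Σ; ∃; _×_; _,_)
open import Data.Sum using (_⊎_; inj₁; inj₂)
open import Function using (_∘_)
open import Function.Bundles using (_⇔_; mk⇔; Equivalence)
open import Relation.Nullary using (does; yes; no; contradiction)
open import Relation.Binary.PropositionalEquality

xor-cancelʳ : ∀ x t → (x xor t) xor t ≡ x
xor-cancelʳ x t = trans (xor-assoc x t t) (trans (cong (x xor_) (xor-same t)) (xor-identityʳ x))

xor≡false⇒≡ : ∀ x y → x xor y ≡ false → y ≡ x
xor≡false⇒≡ false y y≡false = y≡false
xor≡false⇒≡ true  true _    = refl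

xor-cancel-middle : ∀ a t s → (a xor t) xor (t xor s) ≡ a xor s
xor-cancel-middle a t s =
  trans (xor-assoc a t (t xor s))
        (cong (a xor_) (trans (sym (xor-assoc t t s)) (cong (_xor s) (xor-same t))))

∨-disjoint : ∀ x y → x ∧ y ≡ false → x ∨ y ≡ x xor y
∨-disjoint false y     _ = refl
∨-disjoint true  false _ = refl

infixl 6 _⊕_
infixr 7 _⊙_

_⊕_ : ∀ {n} → Vec₂ n → Vec₂ n → Vec₂ n
(x ⊕ y) i = x i xor y i

_⊙_ : ∀ {n} → Bool → Vec₂ n → Vec₂ n
(b ⊙ x) i = b ∧ x i

Σ₂-cong : ∀ {n} {f g : Fin n → Bool} → f ≗ g → Σ₂ f ≡ Σ₂ g
Σ₂-cong {zero}  f≗g = refl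
Σ₂-cong {suc n} f≗g = cong₂ _xor_ (f≗g fzero) (Σ₂-cong (f≗g ∘ fsuc))

Σ₂-false : ∀ n → Σ₂ {n} (λ _ → false) ≡ false
Σ₂-false zero    = refl
Σ₂-false (suc n) = Σ₂-false n

Σ₂-xor : ∀ {n} (f g : Fin n → Bool) → Σ₂ (λ i → f i xor g i) ≡ Σ₂ f xor Σ₂ g
Σ₂-xor {zero}  f g = refl
Σ₂-xor {suc n} f g =
  trans (cong ((f fzero xor g fzero) xor_) (Σ₂-xor (f ∘ fsuc) (g ∘ fsuc)))
        (interchange (f fzero) (g fzero) _ _)

Σ₂-∧ˡ : ∀ {n} b (f : Fin n → Bool) → Σ₂ (λ i → b ∧ f i) ≡ b ∧ Σ₂ f
Σ₂-∧ˡ {zero}  b f = sym (∧-zeroʳ b)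
Σ₂-∧ˡ {suc n} b f =
  trans (cong ((b ∧ f fzero) xor_) (Σ₂-∧ˡ b (f ∘ fsuc))) (sym (∧-distribˡ-xor b (f fzero) _))

Σ₂-∧ʳ : ∀ {n} b (f : Fin n → Bool) → Σ₂ (λ i → f i ∧ b) ≡ Σ₂ f ∧ b
Σ₂-∧ʳ b f = trans (Σ₂-cong (λ i → ∧-comm (f i) b)) (trans (Σ₂-∧ˡ b f) (∧-comm b _))

Σ₂-swap : ∀ {m n} (f : Fin m → Fin n → Bool) →
          Σ₂ (λ i → Σ₂ (f i)) ≡ Σ₂ (λ j → Σ₂ (λ i → f i j))
Σ₂-swap {zero}  {n} f = sym (Σ₂-false n)
Σ₂-swap {suc m}     f =
  trans (cong (Σ₂ (f fzero) xor_) (Σ₂-swap (f ∘ fsuc)))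
        (sym (Σ₂-xor (f fzero) (λ j → Σ₂ (λ i → f (fsuc i) j))))

Σ₂-removeAt : ∀ {n} (f : Fin (suc n) → Bool) j → Σ₂ f ≡ f j xor Σ₂ (removeAt f j)
Σ₂-removeAt         f fzero    = refl
Σ₂-removeAt {suc n} f (fsuc j) =
  trans (cong (f fzero xor_) (Σ₂-removeAt (f ∘ fsuc) j)) (x∙yz≈y∙xz (f fzero) (f (fsuc j)) _)

Σ₂-true⇒∃ : ∀ {n} (f : Fin n → Bool) → Σ₂ f ≡ true → ∃ λ i → f i ≡ true
Σ₂-true⇒∃ {zero}  f ()
Σ₂-true⇒∃ {suc n} f sum≡true with f fzero in eq
... | true  = fzero , eq
... | false with Σ₂-true⇒∃ (f ∘ fsuc) sum≡true
...   | i , fi≡true = fsuc i , fi≡true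

·-comm : ∀ {n} (x y : Vec₂ n) → x · y ≡ y · x
·-comm x y = Σ₂-cong (λ i → ∧-comm (x i) (y i))

·-congʳ : ∀ {n} (x : Vec₂ n) {y z : Vec₂ n} → y ≗ z → x · y ≡ x · z
·-congʳ x y≗z = Σ₂-cong (λ i → cong (x i ∧_) (y≗z i))

·-congˡ : ∀ {n} {x y : Vec₂ n} (z : Vec₂ n) → x ≗ y → x · z ≡ y · z
·-congˡ {x = x} {y} z x≗y = trans (·-comm x z) (trans (·-congʳ z x≗y) (·-comm z y))

·-zeroʳ : ∀ {n} (x : Vec₂ n) → x · 𝟎 ≡ false
·-zeroʳ {n} x = trans (Σ₂-cong (λ i → ∧-zeroʳ (x i))) (Σ₂-false n)

·-⊕ʳ : ∀ {n} (x y z : Vec₂ n) → x · (y ⊕ z) ≡ x · y xor x · z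
·-⊕ʳ x y z = trans (Σ₂-cong (λ i → ∧-distribˡ-xor (x i) (y i) (z i))) (Σ₂-xor (λ i → x i ∧ y i) (λ i → x i ∧ z i))

·-⊙ʳ : ∀ {n} (x : Vec₂ n) b (y : Vec₂ n) → x · (b ⊙ y) ≡ b ∧ x · y
·-⊙ʳ x b y = trans (Σ₂-cong (λ i → x∧yz≡y∧xz (x i) b (y i))) (Σ₂-∧ˡ b (λ i → x i ∧ y i))
  where
  x∧yz≡y∧xz : ∀ u v w → u ∧ (v ∧ w) ≡ v ∧ (u ∧ w)
  x∧yz≡y∧xz u v w = trans (sym (∧-assoc u v w)) (trans (cong (_∧ w) (∧-comm u v)) (∧-assoc v u w))

·-⊕ˡ : ∀ {n} (x y z : Vec₂ n) → (x ⊕ y) · z ≡ x · z xor y · z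
·-⊕ˡ x y z = trans (·-comm (x ⊕ y) z) (trans (·-⊕ʳ z x y) (cong₂ _xor_ (·-comm z x) (·-comm z y)))

·-⊙ˡ : ∀ {n} b (x y : Vec₂ n) → (b ⊙ x) · y ≡ b ∧ x · y
·-⊙ˡ b x y = trans (·-comm (b ⊙ x) y) (trans (·-⊙ʳ y b x) (cong (b ∧_) (·-comm y x)))

·-removeAt : ∀ {n} (x y : Vec₂ (suc n)) j → x · y ≡ (x j ∧ y j) xor removeAt x j · removeAt y j
·-removeAt x y = Σ₂-removeAt (λ i → x i ∧ y i)

·-lincomb : ∀ {n k} (a : Vec₂ n) (v : Fin k → Vec₂ n) (c : Vec₂ k) →
            a · lincomb v c ≡ c · (λ i → a · v i)
·-lincomb a v c =
  trans (Σ₂-cong (λ j → sym (Σ₂-∧ˡ (a j) (λ i → c i ∧ v i j))))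
  (trans (Σ₂-swap (λ j i → a j ∧ (c i ∧ v i j)))
         (Σ₂-cong (λ i → ·-⊙ʳ a (c i) (v i))))

⊛-⊕ : ∀ {m n} (M : Mat₂ m n) (x y : Vec₂ n) → M ⊛ (x ⊕ y) ≗ M ⊛ x ⊕ M ⊛ y
⊛-⊕ M x y i = ·-⊕ʳ (M i) x y

⊛-⊙ : ∀ {m n} (M : Mat₂ m n) b (x : Vec₂ n) → M ⊛ (b ⊙ x) ≗ b ⊙ (M ⊛ x)
⊛-⊙ M b x i = ·-⊙ʳ (M i) b x

InKer-⊕ : ∀ {m n} (M : Mat₂ m n) {x y : Vec₂ n} → InKer M x → InKer M y → InKer M (x ⊕ y)
InKer-⊕ M {x} {y} x∈ker y∈ker i = trans (⊛-⊕ M x y i) (cong₂ _xor_ (x∈ker i) (y∈ker i))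

InKer-⊙ : ∀ {m n} (M : Mat₂ m n) b {x : Vec₂ n} → InKer M x → InKer M (b ⊙ x)
InKer-⊙ M b {x} x∈ker i = trans (⊛-⊙ M b x i) (trans (cong (b ∧_) (x∈ker i)) (∧-zeroʳ b))

InKer-lincomb : ∀ {m n k} (M : Mat₂ m n) (v : Fin k → Vec₂ n) (c : Vec₂ k) →
                (∀ i → InKer M (v i)) → InKer M (lincomb v c)
InKer-lincomb M v c v∈ker j =
  trans (·-lincomb (M j) v c) (trans (·-congʳ c (λ i → v∈ker i j)) (·-zeroʳ c))

lincomb-cong : ∀ {n k} (v : Fin k → Vec₂ n) {c d : Vec₂ k} → c ≗ d → lincomb v c ≗ lincomb v d
lincomb-cong v c≗d j = Σ₂-cong (λ i → cong (_∧ v i j) (c≗d i))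

lincomb-removeAt : ∀ {n k} (v : Fin (suc k) → Vec₂ n) (c : Vec₂ (suc k)) j →
                   lincomb v c ≗ c j ⊙ v j ⊕ lincomb (removeAt v j) (removeAt c j)
lincomb-removeAt v c j l = Σ₂-removeAt (λ i → c i ∧ v i l) j

lincomb-shear : ∀ {n k} (v : Fin k → Vec₂ n) (g : Vec₂ k) (y : Vec₂ n) (c : Vec₂ k) →
                lincomb (λ i → v i ⊕ g i ⊙ y) c ≗ (c · g) ⊙ y ⊕ lincomb v c
lincomb-shear v g y c l =
  trans (Σ₂-cong (λ i → ∧-distribˡ-xor (c i) (v i l) (g i ∧ y l)))
  (trans (Σ₂-xor (λ i → c i ∧ v i l) (λ i → c i ∧ (g i ∧ y l)))
  (trans (cong (lincomb v c l xor_) (trans (Σ₂-cong (λ i → sym (∧-assoc (c i) (g i) (y l))))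
                                          (Σ₂-∧ʳ (y l) (λ i → c i ∧ g i))))
         (xor-comm (lincomb v c l) ((c · g) ∧ y l))))

Symmetric : ∀ {n} → Mat₂ n n → Set
Symmetric M = ∀ i j → M i j ≡ M j i

⊛-selfAdjoint : ∀ {n} (M : Mat₂ n n) → Symmetric M → ∀ x y → (M ⊛ x) · y ≡ x · (M ⊛ y)
⊛-selfAdjoint M M-sym x y =
  trans (Σ₂-cong (λ i → sym (Σ₂-∧ʳ (y i) (λ j → M i j ∧ x j))))
  (trans (Σ₂-swap (λ i j → (M i j ∧ x j) ∧ y i))
         (Σ₂-cong (λ j → trans (Σ₂-cong (λ i → regroup (M i j) (M j i) (x j) (y i) (M-sym i j)))
                                (Σ₂-∧ˡ (x j) (λ i → M j i ∧ y i)))))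
  where
  regroup : ∀ m m′ u w → m ≡ m′ → (m ∧ u) ∧ w ≡ u ∧ (m′ ∧ w)
  regroup m _ u w refl =
    trans (cong (_∧ w) (∧-comm m u)) (∧-assoc u m w)

solution-pairing : ∀ {n} (M : Mat₂ n n) → Symmetric M →
                   ∀ {q a p c} → M ⊛ q ≗ a → M ⊛ p ≗ c → a · p ≡ q · c
solution-pairing M M-sym {q} {a} {p} {c} Mq≗a Mp≗c =
  trans (·-congˡ p (λ i → sym (Mq≗a i)))
        (trans (⊛-selfAdjoint M M-sym q p) (·-congʳ q Mp≗c))

-- The off-diagonal terms xᵢMᵢⱼxⱼ and xⱼMⱼᵢxᵢ cancel in pairs.
quadratic-form : ∀ {n} (M : Mat₂ n n) → Symmetric M → (∀ i → M i i ≡ true) →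
                 ∀ x → x · (M ⊛ x) ≡ x · 𝟏
quadratic-form {zero}  M _     _      x = refl
quadratic-form {suc n} M M-sym M-diag x =
  begin
    (x₀ ∧ ((M fzero fzero ∧ x₀) xor (r · x′))) xor (x′ · ((M ⊛ x) ∘ fsuc))
  ≡⟨ cong₂ _xor_ head-term tail-term ⟩
    (x₀ xor cross) xor (cross xor x′ · 𝟏)
  ≡⟨ xor-cancel-middle x₀ cross (x′ · 𝟏) ⟩
    x₀ xor x′ · 𝟏
  ≡⟨ cong (_xor x′ · 𝟏) (sym (∧-identityʳ x₀)) ⟩
    (x₀ ∧ true) xor x′ · 𝟏
  ∎
  where
  open ≡-Reasoning
  x₀ : Bool
  x₀ = x fzero
  x′ : Vec₂ n
  x′ = tail x
  r : Vec₂ n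
  r j = M fzero (fsuc j)
  M′ : Mat₂ n n
  M′ i j = M (fsuc i) (fsuc j)
  cross : Bool
  cross = x₀ ∧ (r · x′)

  head-term : x₀ ∧ ((M fzero fzero ∧ x₀) xor (r · x′)) ≡ x₀ xor cross
  head-term =
    trans (∧-distribˡ-xor x₀ _ _)
          (cong (_xor cross) (trans (cong (λ m → x₀ ∧ (m ∧ x₀)) (M-diag fzero)) (∧-idem x₀)))

  column : (M ⊛ x) ∘ fsuc ≗ x₀ ⊙ r ⊕ M′ ⊛ x′
  column i = cong (_xor (M′ ⊛ x′) i)
                  (trans (cong (_∧ x₀) (M-sym (fsuc i) fzero)) (∧-comm (M fzero (fsuc i)) x₀))

  tail-term : x′ · ((M ⊛ x) ∘ fsuc) ≡ cross xor x′ · 𝟏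
  tail-term =
    trans (·-congʳ x′ column)
    (trans (·-⊕ʳ x′ (x₀ ⊙ r) (M′ ⊛ x′))
           (cong₂ _xor_ (trans (·-⊙ʳ x′ x₀ r) (cong (x₀ ∧_) (·-comm x′ r)))
                        (quadratic-form M′ (λ i j → M-sym (fsuc i) (fsuc j)) (M-diag ∘ fsuc) x′)))

module KernelHyperplane {r r′ n : ℕ} (M : Mat₂ r n) (M′ : Mat₂ r′ n) (a q : Vec₂ n)
  (ker⊆ker′ : ∀ x → InKer M x → InKer M′ x)
  (a-vanishes-on-ker : ∀ x → InKer M x → a · x ≡ false)
  (ker′∩a⊥⊆ker : ∀ x → InKer M′ x → a · x ≡ false → InKer M x)
  (q∈ker′ : InKer M′ q) (a·q≡true : a · q ≡ true) where

  projection : Vec₂ n → Vec₂ n → Vec₂ n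
  projection y x = x ⊕ (a · x) ⊙ y

  ·-projection : ∀ {y} → a · y ≡ true → ∀ x → a · projection y x ≡ false
  ·-projection {y} a·y≡true x =
    trans (·-⊕ʳ a x ((a · x) ⊙ y))
          (trans (cong ((a · x) xor_) (trans (·-⊙ʳ a (a · x) y)
                                             (trans (cong ((a · x) ∧_) a·y≡true) (∧-identityʳ (a · x)))))
                 (xor-same (a · x)))

  projection∈ker : ∀ {x y} → InKer M′ x → InKer M′ y → a · y ≡ true → InKer M (projection y x)
  projection∈ker {x} {y} x∈ker′ y∈ker′ a·y≡true =
    ker′∩a⊥⊆ker (projection y x) (InKer-⊕ M′ x∈ker′ (InKer-⊙ M′ (a · x) y∈ker′))
                (·-projection a·y≡true x)

  extend : ∀ {k} → HasNullity M k → HasNullity M′ (suc k)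
  extend {k} (v , v∈ker , v-independent , v-spans) = q ∷ v , w∈ker′ , w-independent , w-spans
    where
    w∈ker′ : ∀ i → InKer M′ ((q ∷ v) i)
    w∈ker′ fzero    = q∈ker′
    w∈ker′ (fsuc i) = ker⊆ker′ (v i) (v∈ker i)

    a·lincomb : ∀ c → a · lincomb (q ∷ v) c ≡ c fzero
    a·lincomb c =
      trans (·-⊕ʳ a (c fzero ⊙ q) (lincomb v (tail c)))
      (trans (cong₂ _xor_ (trans (·-⊙ʳ a (c fzero) q) (trans (cong (c fzero ∧_) a·q≡true) (∧-identityʳ _)))
                          (a-vanishes-on-ker _ (InKer-lincomb M v (tail c) v∈ker)))
             (xor-identityʳ (c fzero)))

    w-independent : ∀ c → lincomb (q ∷ v) c ≗ 𝟎 → c ≗ 𝟎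
    w-independent c comb≗𝟎 = c≗𝟎
      where
      c₀≡false : c fzero ≡ false
      c₀≡false = trans (sym (a·lincomb c)) (trans (·-congʳ a comb≗𝟎) (·-zeroʳ a))

      c≗𝟎 : c ≗ 𝟎
      c≗𝟎 fzero    = c₀≡false
      c≗𝟎 (fsuc i) = v-independent (tail c) tail-comb≗𝟎 i
        where
        tail-comb≗𝟎 : lincomb v (tail c) ≗ 𝟎
        tail-comb≗𝟎 l =
          trans (cong (λ b → (b ∧ q l) xor lincomb v (tail c) l) (sym c₀≡false)) (comb≗𝟎 l)

    w-spans : ∀ x → InKer M′ x → Σ (Vec₂ (suc k)) λ c → lincomb (q ∷ v) c ≗ x
    w-spans x x∈ker′ with v-spans (projection q x) (projection∈ker x∈ker′ q∈ker′ a·q≡true)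
    ... | c , c-spans = (a · x) ∷ c , λ l →
      trans (cong (((a · x) ∧ q l) xor_) (c-spans l))
            (trans (xor-comm ((a · x) ∧ q l) (projection q x l)) (xor-cancelʳ (x l) ((a · x) ∧ q l)))

  pivot : ∀ {k} (w : Fin k → Vec₂ n) → (∀ x → InKer M′ x → Σ (Vec₂ k) λ c → lincomb w c ≗ x) →
          ∃ λ j → a · w j ≡ true
  pivot w w-spans with w-spans q q∈ker′
  ... | c , c-spans with Σ₂-true⇒∃ (λ i → c i ∧ a · w i)
                                   (trans (sym (·-lincomb a w c)) (trans (·-congʳ a c-spans) a·q≡true))
  ...   | j , cj∧a·wj≡true = j , ∧-true-right (c j) cj∧a·wj≡true
    where
    ∧-true-right : ∀ b {b′} → b ∧ b′ ≡ true → b′ ≡ true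
    ∧-true-right true eq = eq

  restrict : ∀ {k} (w : Fin (suc k) → Vec₂ n) → IsKerBasis M′ w → ∀ j → a · w j ≡ true →
             IsKerBasis M (λ i → projection (w j) (removeAt w j i))
  restrict {k} w (w∈ker′ , w-independent , w-spans) j a·wj≡true = u∈ker , u-independent , u-spans
    where
    w′ : Fin k → Vec₂ n
    w′ = removeAt w j
    f′ : Vec₂ k
    f′ i = a · w′ i
    u : Fin k → Vec₂ n
    u i = projection (w j) (w′ i)

    u∈ker : ∀ i → InKer M (u i)
    u∈ker i = projection∈ker (w∈ker′ _) (w∈ker′ j) a·wj≡true

    lincomb-u : ∀ c → lincomb u c ≗ (c · f′) ⊙ w j ⊕ lincomb w′ c
    lincomb-u = lincomb-shear w′ f′ (w j)

    u-independent : ∀ c → lincomb u c ≗ 𝟎 → c ≗ 𝟎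
    u-independent c comb≗𝟎 i =
      trans (sym (removeAt-insertAt c j (c · f′) i)) (w-independent d lincomb-w-d≗𝟎 _)
      where
      d : Vec₂ (suc k)
      d = insertAt c j (c · f′)
      lincomb-w-d≗𝟎 : lincomb w d ≗ 𝟎
      lincomb-w-d≗𝟎 l =
        trans (lincomb-removeAt w d j l)
        (trans (cong₂ (λ s t → (s ∧ w j l) xor t)
                      (insertAt-lookup c j (c · f′)) (lincomb-cong w′ (removeAt-insertAt c j (c · f′)) l))
        (trans (sym (lincomb-u c l)) (comb≗𝟎 l)))

    u-spans : ∀ x → InKer M x → Σ (Vec₂ k) λ c → lincomb u c ≗ x
    u-spans x x∈ker with w-spans x (ker⊆ker′ x x∈ker)
    ... | d , d-spans = removeAt d j , λ l →
      trans (lincomb-u (removeAt d j) l)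
      (trans (cong (λ s → (s ∧ w j l) xor lincomb w′ (removeAt d j) l) c·f′≡dj)
      (trans (sym (lincomb-removeAt w d j l)) (d-spans l)))
      where
      c·f′≡dj : removeAt d j · f′ ≡ d j
      c·f′≡dj = xor≡false⇒≡ (d j) (removeAt d j · f′) (begin
          d j xor removeAt d j · f′
        ≡⟨ cong (_xor removeAt d j · f′) (sym (trans (cong (d j ∧_) a·wj≡true) (∧-identityʳ (d j)))) ⟩
          (d j ∧ a · w j) xor removeAt d j · f′
        ≡⟨ sym (·-removeAt d (λ i → a · w i) j) ⟩
          d · (λ i → a · w i)
        ≡⟨ sym (·-lincomb a w d) ⟩
          a · lincomb w d
        ≡⟨ ·-congʳ a d-spans ⟩
          a · x
        ≡⟨ a-vanishes-on-ker x x∈ker ⟩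
          false
        ∎)
        where open ≡-Reasoning

  shrink : ∀ {k} → HasNullity M′ (suc k) → HasNullity M k
  shrink (w , basis@(_ , _ , w-spans)) with pivot w w-spans
  ... | j , a·wj≡true = _ , restrict w basis j a·wj≡true

  hasNullity⇔ : ∀ k → HasNullity M k ⇔ HasNullity M′ (suc k)
  hasNullity⇔ _ = mk⇔ extend shrink

∪-disjoint : ∀ {n} (A₁ A₂ : Vec₂ n) → Disjoint A₁ A₂ → A₁ ∪ A₂ ≗ A₁ ⊕ A₂
∪-disjoint A₁ A₂ d i = ∨-disjoint (A₁ i) (A₂ i) (d i)

N-symmetric : ∀ {n} (H : Graph n) → Symmetric (N H)
N-symmetric H i j = cong₂ _∨_ (does-sym i j) (adj-sym H i j)
  where
  does-sym : ∀ {n} (i j : Fin n) → does (i ≟ j) ≡ does (j ≟ i)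
  does-sym i j with i ≟ j | j ≟ i
  ... | yes _   | yes _   = refl
  ... | no  _   | no  _   = refl
  ... | yes i≡j | no  j≢i = contradiction (sym i≡j) j≢i
  ... | no  i≢j | yes j≡i = contradiction (sym j≡i) i≢j

N-diagonal : ∀ {n} (H : Graph n) i → N H i i ≡ true
N-diagonal H i with i ≟ i
... | yes _   = refl
... | no  i≢i = contradiction refl i≢i

Solves-pairing : ∀ {n} (H : Graph n) {q a p c} → Solves H q a → Solves H p c → a · p ≡ q · c
Solves-pairing H = solution-pairing (N H) (N-symmetric H)

Solves-self-pairing : ∀ {n} (H : Graph n) {q a} → Solves H q a → q · a ≡ q · 𝟏
Solves-self-pairing H {q} q-solves =
  trans (·-congʳ q (λ i → sym (q-solves i))) (quadratic-form (N H) (N-symmetric H) (N-diagonal H) q)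

Solves-cong : ∀ {n} (H : Graph n) {p c c′ : Vec₂ n} → c ≗ c′ → Solves H p c → Solves H p c′
Solves-cong H c≗c′ p-solves i = trans (p-solves i) (c≗c′ i)

module _ {n} (G : Graph n) {A₁ A₂ : Vec₂ n} (d : Disjoint A₁ A₂) where

  N-toggle-row : ∀ i → N (toggle G A₁ A₂ d) i ≗ N G i ⊕ (A₁ i ⊙ A₂ ⊕ A₂ i ⊙ A₁)
  N-toggle-row i j with i ≟ j
  ... | yes refl rewrite d i | ∧-comm (A₂ i) (A₁ i) | d i = refl
  ... | no  _ =
    cong (adj G i j xor_)
         (∨-disjoint (A₁ i ∧ A₂ j) (A₂ i ∧ A₁ j) (cross-disjoint (A₁ i) (A₂ j) (A₂ i) (A₁ j) (d i)))
    where
    cross-disjoint : ∀ a b c e → a ∧ c ≡ false → (a ∧ b) ∧ (c ∧ e) ≡ false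
    cross-disjoint false b c     e _ = refl
    cross-disjoint true  b false e _ = ∧-zeroʳ b

  N-toggle : ∀ p → N (toggle G A₁ A₂ d) ⊛ p ≗ N G ⊛ p ⊕ ((A₂ · p) ⊙ A₁ ⊕ (A₁ · p) ⊙ A₂)
  N-toggle p i =
    trans (·-congˡ p (N-toggle-row i))
    (trans (·-⊕ˡ (N G i) (A₁ i ⊙ A₂ ⊕ A₂ i ⊙ A₁) p)
    (cong ((N G ⊛ p) i xor_)
    (trans (·-⊕ˡ (A₁ i ⊙ A₂) (A₂ i ⊙ A₁) p)
           (cong₂ _xor_ (trans (·-⊙ˡ (A₁ i) A₂ p) (∧-comm (A₁ i) (A₂ · p)))
                        (trans (·-⊙ˡ (A₂ i) A₁ p) (∧-comm (A₂ i) (A₁ · p)))))))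

module Toggling {n} (G : Graph n) (A₁ A₂ : Vec₂ n) (d : Disjoint A₁ A₂)
  {p₀ q₁ q₂ : Vec₂ n} (p₀-solves : Solves G p₀ 𝟏)
  (q₁-solves : Solves G q₁ A₁) (q₂-solves : Solves G q₂ A₂)
  (q₁·𝟏≡false : q₁ · 𝟏 ≡ false) (q₂·𝟏≡true : q₂ · 𝟏 ≡ true) (q₂·A₁≡true : q₂ · A₁ ≡ true) where

  G* : Graph n
  G* = toggle G A₁ A₂ d

  correction : Bool → Bool → Vec₂ n
  correction β α = β ⊙ A₁ ⊕ α ⊙ A₂

  q₁·A₁≡false : q₁ · A₁ ≡ false
  q₁·A₁≡false = trans (Solves-self-pairing G q₁-solves) q₁·𝟏≡false

  q₂·A₂≡true : q₂ · A₂ ≡ true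
  q₂·A₂≡true = trans (Solves-self-pairing G q₂-solves) q₂·𝟏≡true

  A₂·q₁≡true : A₂ · q₁ ≡ true
  A₂·q₁≡true = trans (Solves-pairing G q₂-solves q₁-solves) q₂·A₁≡true

  q₁·A₂≡true : q₁ · A₂ ≡ true
  q₁·A₂≡true = trans (·-comm q₁ A₂) A₂·q₁≡true

  toggled-solves : ∀ {p c β α} → Solves G p c → q₂ · c ≡ β → q₁ · c ≡ α →
                   Solves G* p (c ⊕ correction β α)
  toggled-solves {p} p-solves refl refl i =
    trans (N-toggle G d p i)
          (cong₂ _xor_ (p-solves i)
                 (cong₂ (λ β α → (β ∧ A₁ i) xor (α ∧ A₂ i)) (Solves-pairing G q₂-solves p-solves)
                                                            (Solves-pairing G q₁-solves p-solves)))

  untoggled-solves : ∀ {p c β α} → Solves G* p c → A₂ · p ≡ β → A₁ · p ≡ α →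
                     Solves G p (c ⊕ correction β α)
  untoggled-solves {p} p-solves* refl refl i =
    trans (sym (xor-cancelʳ ((N G ⊛ p) i) (correction (A₂ · p) (A₁ · p) i)))
          (cong (_xor correction (A₂ · p) (A₁ · p) i) (trans (sym (N-toggle G d p i)) (p-solves* i)))

  q₁∈ker* : InKer (N G*) q₁
  q₁∈ker* = Solves-cong G* (λ i → trans (cong (A₁ i xor_) (xor-identityʳ (A₁ i))) (xor-same (A₁ i)))
                        (toggled-solves q₁-solves q₂·A₁≡true q₁·A₁≡false)

  q₂-solves* : Solves G* q₂ A₁
  q₂-solves* = Solves-cong G* (λ i → trans (x∙yz≈y∙xz (A₂ i) (A₁ i) (A₂ i)) (cancel (A₁ i) (A₂ i)))
                           (toggled-solves q₂-solves q₂·A₂≡true q₁·A₂≡true)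
    where
    cancel : ∀ x y → x xor (y xor y) ≡ x
    cancel x y = trans (cong (x xor_) (xor-same y)) (xor-identityʳ x)

  A₁·p≡true : ∀ {p} → Solves G* p 𝟏 → A₁ · p ≡ true
  A₁·p≡true p-solves* = trans (Solves-pairing G* q₂-solves* p-solves*) (q₂·𝟏≡true)

  solves-complement : ∀ {p x β α} → Solves G p (‾ x) → q₂ · ‾ x ≡ β → q₁ · ‾ x ≡ α →
                      x ≗ correction β α → Solves G* p 𝟏
  solves-complement {x = x} p-solves q₂·c q₁·c x≗correction =
    Solves-cong G* (λ i → trans (cong ((x i xor true) xor_) (sym (x≗correction i))) (complement-xor (x i)))
                   (toggled-solves p-solves q₂·c q₁·c)
    where
    complement-xor : ∀ b → (b xor true) xor b ≡ true
    complement-xor false = refl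
    complement-xor true  = refl

  solutions : ∀ p → Solves G* p 𝟏 ⇔ (Solves G p (‾ A₂) ⊎ Solves G p (‾ (A₁ ∪ A₂)))
  solutions p = mk⇔ to from
    where
    to : Solves G* p 𝟏 → Solves G p (‾ A₂) ⊎ Solves G p (‾ (A₁ ∪ A₂))
    to p-solves* with A₂ · p in A₂·p
    ... | false = inj₁ (Solves-cong G (λ i → xor-comm true (A₂ i))
                                    (untoggled-solves p-solves* A₂·p (A₁·p≡true p-solves*)))
    ... | true  = inj₂ (Solves-cong G (λ i → trans (xor-comm true (A₁ i xor A₂ i))
                                                   (cong (_xor true) (sym (∪-disjoint A₁ A₂ d i))))
                                    (untoggled-solves p-solves* A₂·p (A₁·p≡true p-solves*)))

    from : Solves G p (‾ A₂) ⊎ Solves G p (‾ (A₁ ∪ A₂)) → Solves G* p 𝟏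
    from (inj₁ p-solves) =
      solves-complement p-solves (trans (·-⊕ʳ q₂ A₂ 𝟏) (cong₂ _xor_ q₂·A₂≡true q₂·𝟏≡true))
                                 (trans (·-⊕ʳ q₁ A₂ 𝟏) (cong₂ _xor_ q₁·A₂≡true q₁·𝟏≡false))
                                 (λ _ → refl)
    from (inj₂ p-solves) =
      solves-complement {x = A₁ ⊕ A₂}
        (Solves-cong G (λ i → cong (_xor true) (∪-disjoint A₁ A₂ d i)) p-solves)
        (trans (·-⊕ʳ q₂ (A₁ ⊕ A₂) 𝟏)
               (cong₂ _xor_ (trans (·-⊕ʳ q₂ A₁ A₂) (cong₂ _xor_ q₂·A₁≡true q₂·A₂≡true)) q₂·𝟏≡true))
        (trans (·-⊕ʳ q₁ (A₁ ⊕ A₂) 𝟏)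
               (cong₂ _xor_ (trans (·-⊕ʳ q₁ A₁ A₂) (cong₂ _xor_ q₁·A₁≡false q₁·A₂≡true)) q₁·𝟏≡false))
        (λ _ → refl)

  A₁-AO* : AO G* A₁
  A₁-AO* = (q₂ , q₂-solves*)
         , (p₀ ⊕ q₂ , Equivalence.from (solutions (p₀ ⊕ q₂)) (inj₁ p₀⊕q₂-solves))
         , λ p → A₁·p≡true
    where
    p₀⊕q₂-solves : Solves G (p₀ ⊕ q₂) (‾ A₂)
    p₀⊕q₂-solves i =
      trans (⊛-⊕ (N G) p₀ q₂ i) (trans (cong₂ _xor_ (p₀-solves i) (q₂-solves i)) (xor-comm true (A₂ i)))

  A₂-HO* : HO G* A₂
  A₂-HO* (p , p-solves*)
    with trans (sym A₂·q₁≡true) (trans (Solves-pairing G* p-solves* q₁∈ker*) (·-zeroʳ p))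
  ... | ()

  nullity-suc : ∀ k → ν≡ G k ⇔ ν≡ G* (suc k)
  nullity-suc = KernelHyperplane.hasNullity⇔ (N G) (N G*) A₂ q₁
    (λ x x∈ker → toggled-solves x∈ker (·-zeroʳ q₂) (·-zeroʳ q₁))
    (λ x x∈ker → trans (Solves-pairing G q₂-solves x∈ker) (·-zeroʳ q₂))
    (λ x x∈ker* A₂·x≡false →
       untoggled-solves x∈ker* A₂·x≡false (trans (Solves-pairing G* q₂-solves* x∈ker*) (·-zeroʳ q₂)))
    q₁∈ker* A₂·q₁≡true

mainTheorem11 : (n : ℕ) (G : Graph n) (A₁ A₂ : Vec₂ n) (d : Disjoint A₁ A₂) →
    NO G A₁ → AO G A₂ → ((‾ A₁) -NO) G A₂ →
    ((p : Vec₂ n) →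
      Solves (toggle G A₁ A₂ d) p 𝟏 ⇔ (Solves G p (‾ A₂) ⊎ Solves G p (‾ (A₁ ∪ A₂))))
    × AO (toggle G A₁ A₂ d) A₁
    × HO (toggle G A₁ A₂ d) A₂
    × ((k : ℕ) → ν≡ G k ⇔ ν≡ (toggle G A₁ A₂ d) (suc k))
mainTheorem11 n G A₁ A₂ d ((q₁ , q₁-solves) , (p₀ , p₀-solves) , A₁-NO)
                          ((q₂ , q₂-solves) , _ , A₂-AO) (_ , (r , r-solves) , A₂-‾A₁-NO) =
  solutions , A₁-AO* , A₂-HO* , nullity-suc
  where
  q₁·𝟏≡false : q₁ · 𝟏 ≡ false
  q₁·𝟏≡false = trans (sym (Solves-pairing G q₁-solves p₀-solves)) (A₁-NO p₀ p₀-solves)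

  q₂·𝟏≡true : q₂ · 𝟏 ≡ true
  q₂·𝟏≡true = trans (sym (Solves-pairing G q₂-solves p₀-solves)) (A₂-AO p₀ p₀-solves)

  q₂·A₁≡true : q₂ · A₁ ≡ true
  q₂·A₁≡true = xor-true≡false (q₂ · A₁) (begin
      q₂ · A₁ xor true      ≡⟨ cong (q₂ · A₁ xor_) (sym q₂·𝟏≡true) ⟩
      q₂ · A₁ xor q₂ · 𝟏    ≡⟨ sym (·-⊕ʳ q₂ A₁ 𝟏) ⟩
      q₂ · ‾ A₁             ≡⟨ sym (Solves-pairing G q₂-solves r-solves) ⟩
      A₂ · r                ≡⟨ A₂-‾A₁-NO r r-solves ⟩
      false                 ∎)
    where
    open ≡-Reasoning
    xor-true≡false : ∀ b → b xor true ≡ false → b ≡ true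
    xor-true≡false true _ = refl

  open Toggling G A₁ A₂ d p₀-solves q₁-solves q₂-solves q₁·𝟏≡false q₂·𝟏≡true q₂·A₁≡true
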